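{- Let $\mathcal{I}$ be an instance of the extended version with $|U(\mathcal{I})|=q$. For a feasible assignment $f$ and $r\in\mathbb{Z}_{>0}$ let $\varphi_{f,r}:U(\mathcal{I})\to[q]$, $i\mapsto f(i,r)$ (this is a bijection). Let $f_1,f_2,\ldots$ be an infinite sequence of feasible assignments, let $\pi_1$ be an arbitrary permutation of $[q]$, and define permutations $\pi_r$ of $[q]$ inductively by $\pi_{r+1}=\pi_r\circ\varphi_{f_r,2}\circ\varphi_{f_{r+1},1}^{ -1}$. Then the map $g:[n]\times\mathbb{Z}_{>0}\to[q]$, $g(i,r)=\pi_r(f_r(i,1))$, is a feasible assignment.
   Context: Tasks: $n$ intervals $[s_i,e_i)\subseteq(-1,1)$, $i\in[n]$, with $e_i\in(0,1]$, $e_i-s_i\le 1$; the $r$th occurrence ($r\in\mathbb{Z}_{>0}$) of task $i$ occupies $[s_i+r,e_i+r)$; $q$ is a positive integer and workers are identified with $[q]$. $U(\mathcal{I})=\{i\in[n]: s_i\le 0\}$. A schedule is a pair $(T,W)$ with $T\subseteq[n]$ and either $W=\varnothing$ or $W=\{i\}$ with $i\in U(\mathcal{I})$; it is non-overlapping if for all $i'\in T$: $[s_{i'},e_{i'})\cap[s_{i''},e_{i''})=\varnothing$ for all $i''\in T\setminus\{i'\}$ and $[s_{i'},e_{i'})\cap[s_i+1,e_i+1)=\varnothing$ for all $i\in W$. An instance of the extended version is $\bigl(([s_i,e_i))_{i\in[n]},q,\mathcal{S}\bigr)$ with $\mathcal{S}$ a set of non-overlapping schedules. An assignment is a map $f:[n]\times\mathbb{Z}_{>0}\to[q]$;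 for worker $j$ and week $r\in\mathbb{Z}_{>0}$ its induced schedule is $(T,W)$ with $T=\{i: f(i,r)=j\}$, $W=\{i\in U(\mathcal{I}): f(i,r+1)=j\}$; $f$ is feasible if all its induced schedules belong to $\mathcal{S}$. (The basic version is the case where $\mathcal{S}$ is the set of all non-overlapping schedules; there, feasibility means that overlapping occurrences $[s_i+r,e_i+r)$, $[s_{i'}+r',e_{i'}+r')$, $i\ne i'$, are assigned to distinct workers.) -}

module Defs where

open import Level using (0ℓ)
open import Data.Nat as ℕ using (ℕ; suc)
open import Data.Fin using (Fin)
open import Data.Fin.Subset as Sub using (Subset; _∈_; ⁅_⁆; ∣_∣)
open import Data.Product using (Σ; ∃; _×_; _,_; proj₁; proj₂)
open import Data.Sum using (_⊎_)
open import Data.Empty as E using ()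
open import Relation.Binary.PropositionalEquality using (_≡_; _≢_)
open import Function.Bundles using (_⇔_)
open import Data.Fin.Permutation using (Permutation′; _⟨$⟩ʳ_)

-- The paper uses ℝ;
-- the standard library has no reals, so we quantify over an arbitrary
-- structure with order relations, addition and constants 0, 1, -1.
-- (ℝ with its usual structure is one instance.)
record Line : Set₁ where
  field
    R       : Set
    _≤_ _<_ : R → R → Set
    _+_     : R → R → R
    0# 1# -1# : R
  infix 4 _≤_ _<_
  infixl 6 _+_

module _ (L : Line) where
  open Line L

  Disjoint : R → R → R → R → Set
  Disjoint a b c d = ∀ x → a ≤ x → x < b → c ≤ x → x < d → E.⊥

  Sched : ℕ → Set
  Sched n = Subset n × Subset n

  module _ {n : ℕ} (s e : Fin n → R) where

    InU : Fin n → Set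
    InU i = s i ≤ 0#

    IsSchedule : Sched n → Set
    IsSchedule (T , W) = (W ≡ Sub.⊥) ⊎ (Σ (Fin n) λ i → InU i × W ≡ ⁅ i ⁆)

    NonOverlapping : Sched n → Set
    NonOverlapping (T , W) = ∀ i' → i' ∈ T →
        (∀ i'' → i'' ∈ T → i'' ≢ i' → Disjoint (s i') (e i') (s i'') (e i''))
      × (∀ i → i ∈ W → Disjoint (s i') (e i') (s i + 1#) (e i + 1#))

  record Instance : Set₁ where
    field
      n q  : ℕ
      q-pos : 1 ℕ.≤ q
      s e  : Fin n → R
      int⊆ : ∀ i x → s i ≤ x → x < e i → (-1# < x × x < 1#)
      e>0  : ∀ i → 0# < e i
      e≤1  : ∀ i → e i ≤ 1#
      len≤1 : ∀ i → e i ≤ s i + 1#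
      S    : Sched n → Set
      S-ok : ∀ σ → S σ → IsSchedule s e σ × NonOverlapping s e σ

  module _ (I : Instance) where
    open Instance I

    -- assignments f : [n] × ℤ_{>0} → [q]; weeks are naturals r ≥ 1
    -- (the value at r = 0 is irrelevant)
    Assignment : Set
    Assignment = Fin n → ℕ → Fin q

    IsInduced : Assignment → Fin q → ℕ → Sched n → Set
    IsInduced f j r (T , W) = ∀ i →
        (i ∈ T ⇔ f i r ≡ j) × (i ∈ W ⇔ (InU s e i × f i (suc r) ≡ j))

    Feasible : Assignment → Set
    Feasible f = ∀ r → 1 ℕ.≤ r → ∀ (j : Fin q) →
      Σ (Sched n) λ σ → S σ × IsInduced f j r σ

    φ-Bijective : Assignment → ℕ → Set
    φ-Bijective f r =
        (∀ i i' → InU s e i → InU s e i' → f i r ≡ f i' r → i ≡ i')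
      × (∀ (j : Fin q) → Σ (Fin n) λ i → InU s e i × f i r ≡ j)

    -- π_{r+1} = π_r ∘ φ_{f_r,2} ∘ φ_{f_{r+1},1}⁻¹, stated as
    -- π_{r+1}(φ_{f_{r+1},1}(i)) = π_r(φ_{f_r,2}(i)) for all i ∈ U(I)
    -- (this determines π_{r+1} uniquely since φ_{f_{r+1},1} is onto [q])
    PiRecursion : (ℕ → Assignment) → (ℕ → Permutation′ q) → Set
    PiRecursion f π = ∀ r → 1 ℕ.≤ r → ∀ i → InU s e i →
      π (suc r) ⟨$⟩ʳ f (suc r) i 1 ≡ π r ⟨$⟩ʳ f r i 2

    glue : (ℕ → Assignment) → (ℕ → Permutation′ q) → Assignment
    glue f π i r = π r ⟨$⟩ʳ f r i 1

    IsU : Subset n → Set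
    IsU U = ∀ i → (i ∈ U ⇔ InU s e i)

-- A task of U(I) starts at or before 0 and ends after 0, so all occurrences of
-- U-tasks in one week share a time point; in a feasible assignment they go to
-- pairwise distinct workers, and an injection of U into [q] with |U| = q is onto.
--
-- For the gluing, worker j in week r of g does exactly what worker πᵣ⁻¹(j) does in
-- week 1 of fᵣ, and the recursion for π makes the U-tasks of week r+1 of g those of
-- week 2 of fᵣ.  So each induced schedule of g is an induced schedule of some fᵣ.
module Submission where

open import Defs
open import Data.Nat using (ℕ; _≤_; _<_; suc; z≤n; s≤s)
open import Data.Nat.Properties using (<-irrefl)
open import Data.Fin using (Fin; zero; suc; punchOut)
open import Data.Fin.Properties using (any?; 0≢1+n; suc-injective; punchOut-injective; _≟_)
open import Data.Fin.Subset using (Subset; ∣_∣; _∈_; inside; outside)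
open import Data.Fin.Subset.Properties using (_∈?_)
open import Data.Vec using (_∷_; []; here; there)
open import Data.Product using (∃; _×_; _,_; proj₁; proj₂)
open import Data.Empty using (⊥-elim)
open import Function using (_∘_)
open import Relation.Nullary using (¬_; yes; no)
open import Relation.Nullary.Decidable using (_×-dec_)
open import Relation.Binary.PropositionalEquality using (_≡_; _≢_; refl; sym; trans; cong)
open import Data.Fin.Permutation using (Permutation′; _⟨$⟩ʳ_; _⟨$⟩ˡ_; inverseˡ; inverseʳ)
open import Function.Bundles using (_⇔_; mk⇔; Equivalence)
open import Function.Construct.Composition using (_⇔-∘_)
open import Function.Construct.Symmetry using (⇔-sym)

open Equivalence

InjectiveOn : ∀ {n} {A : Set} (U : Subset n) → (∀ i → i ∈ U → A) → Set
InjectiveOn U g = ∀ {i i'} (p : i ∈ U) (p' : i' ∈ U) → g i p ≡ g i' p' → i ≡ i'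

mutual
  ∣∣≤-injectiveOn : ∀ {n m} (U : Subset n) (g : ∀ i → i ∈ U → Fin m) →
    InjectiveOn U g → ∣ U ∣ ≤ m
  ∣∣≤-injectiveOn [] g inj = z≤n
  ∣∣≤-injectiveOn (outside ∷ U) g inj =
    ∣∣≤-injectiveOn U (λ i p → g (suc i) (there p))
      (λ p p' → suc-injective ∘ inj (there p) (there p'))
  ∣∣≤-injectiveOn (inside ∷ U) g inj =
    ∣∣<-injectiveOn-avoiding U (λ i p → g (suc i) (there p))
      (λ p p' → suc-injective ∘ inj (there p) (there p'))
      (g zero here) (λ i p eq → 0≢1+n (inj here (there p) (sym eq)))

  ∣∣<-injectiveOn-avoiding : ∀ {n m} (U : Subset n) (g : ∀ i → i ∈ U → Fin m) →
    InjectiveOn U g → (j : Fin m) → (∀ i p → g i p ≢ j) → ∣ U ∣ < m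
  ∣∣<-injectiveOn-avoiding {m = suc m} U g inj j avoids =
    s≤s (∣∣≤-injectiveOn U g′ λ p p' → inj p p' ∘ punchOut-injective (j≢ p) (j≢ p'))
    where
    j≢ : ∀ {i} (p : i ∈ U) → j ≢ g i p
    j≢ p = avoids _ p ∘ sym

    g′ : ∀ i → i ∈ U → Fin m
    g′ i p = punchOut (j≢ p)

injectiveOn⇒surjective : ∀ {n m} (U : Subset n) (h : Fin n → Fin m) →
  InjectiveOn U (λ i _ → h i) → ∣ U ∣ ≡ m → ∀ j → ∃ λ i → i ∈ U × h i ≡ j
injectiveOn⇒surjective U h inj ∣U∣≡m j with any? (λ i → (i ∈? U) ×-dec (h i ≟ j))
... | yes hit = hit
... | no miss = ⊥-elim (<-irrefl ∣U∣≡m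
      (∣∣<-injectiveOn-avoiding U (λ i _ → h i) inj j λ i p eq → miss (i , p , eq)))

⟨$⟩ʳ≡⇔≡⟨$⟩ˡ : ∀ {q} (π : Permutation′ q) {x y} → (π ⟨$⟩ʳ x ≡ y) ⇔ (x ≡ π ⟨$⟩ˡ y)
⟨$⟩ʳ≡⇔≡⟨$⟩ˡ π = mk⇔ (λ eq → trans (sym (inverseˡ π)) (cong (π ⟨$⟩ˡ_) eq))
                    (λ eq → trans (cong (π ⟨$⟩ʳ_) eq) (inverseʳ π))

module _ (L : Line) (I : Instance L) where
  open Line L using (0#)
  open Instance I

  InU-intervals-overlap : ∀ {i i'} → InU L s e i → InU L s e i' →
    ¬ Disjoint L (s i) (e i) (s i') (e i')
  InU-intervals-overlap {i} {i'} u u' disjoint = disjoint 0# u (e>0 i) u' (e>0 i')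

  feasible⇒φ-injective : (f : Assignment L I) → Feasible L I f → ∀ r → 1 ≤ r →
    ∀ i i' → InU L s e i → InU L s e i' → f i r ≡ f i' r → i ≡ i'
  feasible⇒φ-injective f feasible r 1≤r i i' u u' same-worker with i ≟ i'
  ... | yes i≡i' = i≡i'
  ... | no i≢i' with feasible r 1≤r (f i r)
  ... | σ@(T , _) , σ∈S , induced = ⊥-elim (InU-intervals-overlap u u' disjoint)
    where
    i∈T : i ∈ T
    i∈T = proj₁ (induced i) .from refl

    i'∈T : i' ∈ T
    i'∈T = proj₁ (induced i') .from (sym same-worker)

    disjoint : Disjoint L (s i) (e i) (s i') (e i')
    disjoint = proj₁ (proj₂ (S-ok σ σ∈S) i i∈T) i' i'∈T (i≢i' ∘ sym)

  feasible⇒φ-bijective : (U : Subset n) → IsU L I U → ∣ U ∣ ≡ q →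
    (f : Assignment L I) → Feasible L I f → ∀ r → 1 ≤ r → φ-Bijective L I f r
  feasible⇒φ-bijective U isU ∣U∣≡q f feasible r 1≤r = injective , surjective
    where
    injective : ∀ i i' → InU L s e i → InU L s e i' → f i r ≡ f i' r → i ≡ i'
    injective = feasible⇒φ-injective f feasible r 1≤r

    surjective : ∀ j → ∃ λ i → InU L s e i × f i r ≡ j
    surjective j with injectiveOn⇒surjective U (λ i → f i r)
                        (λ p p' → injective _ _ (isU _ .to p) (isU _ .to p')) ∣U∣≡q j
    ... | i , i∈U , eq = i , isU i .to i∈U , eq

  IsInduced-transfer : ∀ {f f' j j' r r'} →
    (∀ i → (f i r ≡ j) ⇔ (f' i r' ≡ j')) →
    (∀ i → InU L s e i → (f i (suc r) ≡ j) ⇔ (f' i (suc r') ≡ j')) →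
    ∀ {σ} → IsInduced L I f j r σ → IsInduced L I f' j' r' σ
  IsInduced-transfer this-week next-week induced i =
      this-week i ⇔-∘ proj₁ (induced i)
    , mk⇔ (λ i∈W → let u , eq = proj₂ (induced i) .to i∈W in u , next-week i u .to eq)
          (λ (u , eq) → proj₂ (induced i) .from (u , next-week i u .from eq))

  glue-feasible : (f : ℕ → Assignment L I) → (∀ k → 1 ≤ k → Feasible L I (f k)) →
    (π : ℕ → Permutation′ q) → PiRecursion L I f π → Feasible L I (glue L I f π)
  glue-feasible f feasible π recursion r 1≤r j
    with feasible r 1≤r 1 (s≤s z≤n) (π r ⟨$⟩ˡ j)
  ... | σ , σ∈S , induced =
    σ , σ∈S , IsInduced-transfer {f = f r} {f' = glue L I f π} this-week next-week induced
    where
    this-week : ∀ i → (f r i 1 ≡ π r ⟨$⟩ˡ j) ⇔ (glue L I f π i r ≡ j)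
    this-week i = ⇔-sym (⟨$⟩ʳ≡⇔≡⟨$⟩ˡ (π r))

    next-week : ∀ i → InU L s e i →
      (f r i 2 ≡ π r ⟨$⟩ˡ j) ⇔ (glue L I f π i (suc r) ≡ j)
    next-week i u = mk⇔ (trans (recursion r 1≤r i u) ∘ ⟨$⟩ʳ≡⇔≡⟨$⟩ˡ (π r) .from)
                        (⟨$⟩ʳ≡⇔≡⟨$⟩ˡ (π r) .to ∘ trans (sym (recursion r 1≤r i u)))

lemma2p1 : (L : Line) (I : Instance L) →
    (U : Subset (Instance.n I)) → IsU L I U → ∣ U ∣ ≡ Instance.q I →
    ((f : Assignment L I) → Feasible L I f → ∀ r → 1 ≤ r → φ-Bijective L I f r)
    × ((f : ℕ → Assignment L I) → (∀ k → 1 ≤ k → Feasible L I (f k)) →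
    (π : ℕ → Permutation′ (Instance.q I)) → PiRecursion L I f π →
    Feasible L I (glue L I f π))
lemma2p1 L I U isU ∣U∣≡q = feasible⇒φ-bijective L I U isU ∣U∣≡q , glue-feasible L I
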